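{- Let $n\ge4$. For every statistic $\mathrm{st}\in\{\mathrm r,\mathrm d,\mathrm p,\mathrm v\}$ and all $2\le j<i\le n$, \[ g^{\mathrm{st}}_n(1ij)=g^{\mathrm{st}}_n\bigl(1(j+1)j\bigr). \]
   Context: $\mathcal S_n$ is the set of permutations of $[n]$. For $\pi\in\mathcal S_n$ written in standard cycle form (each cycle begins with its smallest element, cycles ordered left to right by increasing smallest elements), $\mathrm{Flatten}(\pi)$ is the word obtained by erasing the parentheses. For a word $w=w_1\cdots w_m$ of distinct integers: $\mathrm r(w)$ = number of $i$ with $w_i<w_{i+1}<w_{i+2}$; $\mathrm d(w)$ = number of $i$ with $w_i>w_{i+1}>w_{i+2}$; $\mathrm p(w)$ = number of $i$ with $w_{i+1}=\max\{w_i,w_{i+1},w_{i+2}\}$; $\mathrm v(w)$ = number of $i$ with $w_{i+1}=\min\{w_i,w_{i+1},w_{i+2}\}$. For letters $a_1,\dots,a_k$, $g^{\mathrm{st}}_n(a_1\cdots a_k)=\sum_\pi q^{\mathrm{st}(\mathrm{Flatten}(\pi))}$ over $\pi\in\mathcal S_n$ with $\mathrm{Flatten}(\pi)$ beginning with $a_1\cdots a_k$. -}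

module Defs where

open import Data.Nat using (ℕ; zero; suc; _+_; _<ᵇ_; _≡ᵇ_)
open import Data.Bool using (Bool; true; false; _∧_; if_then_else_; not)
open import Data.List using (List; []; _∷_; _++_; map; concatMap; length; filter; upTo)
open import Data.Bool.ListAction using (any)


-- Permutations of [n] in one-line notation.
-- A permutation π ∈ S_n is represented by the list π(1) π(2) ... π(n).

insertions : ℕ → List ℕ → List (List ℕ)
insertions x []       = (x ∷ []) ∷ []
insertions x (y ∷ ys) = (x ∷ y ∷ ys) ∷ map (y ∷_) (insertions x ys)

orderings : List ℕ → List (List ℕ)
orderings []       = [] ∷ []
orderings (x ∷ xs) = concatMap (insertions x) (orderings xs)

range1 : ℕ → List ℕ
range1 n = map suc (upTo n)

Sn : ℕ → List (List ℕ)
Sn n = orderings (range1 n)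

-- π(i) for 1 ≤ i ≤ length π (value 0 outside the domain, never used)
apply : List ℕ → ℕ → ℕ
apply []       _             = 0
apply (y ∷ ys) zero          = 0
apply (y ∷ ys) (suc zero)    = y
apply (y ∷ ys) (suc (suc i)) = apply ys (suc i)

elem : ℕ → List ℕ → Bool
elem x = any (x ≡ᵇ_)

-- Standard cycle form and Flatten.
-- cycleFrom π fuel m x  lists x, π(x), π²(x), ... stopping before
-- returning to m (fuel n suffices since cycles have length ≤ n).
cycleFrom : List ℕ → ℕ → ℕ → ℕ → List ℕ
cycleFrom π zero       m x = []
cycleFrom π (suc fuel) m x =
  x ∷ (if apply π x ≡ᵇ m then [] else cycleFrom π fuel m (apply π x))

-- scan candidates in increasing order; each not-yet-seen element is the
-- smallest element of a new cycle, whose cycle (starting with it) is appended.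
flattenAux : List ℕ → ℕ → List ℕ → List ℕ → List ℕ
flattenAux π n seen []       = seen
flattenAux π n seen (m ∷ ms) =
  if elem m seen then flattenAux π n seen ms
  else flattenAux π n (seen ++ cycleFrom π n m m) ms

Flatten : ℕ → List ℕ → List ℕ
Flatten n π = flattenAux π n [] (range1 n)

data Stat : Set where
  r d p v : Stat

-- does the triple (a , b , c) = (w_i , w_{i+1} , w_{i+2}) count for st?
-- (entries are distinct, so the max/min conditions are strict comparisons)
counts : Stat → ℕ → ℕ → ℕ → Bool
counts r a b c = (a <ᵇ b) ∧ (b <ᵇ c)
counts d a b c = (b <ᵇ a) ∧ (c <ᵇ b)
counts p a b c = (a <ᵇ b) ∧ (c <ᵇ b)
counts v a b c = (b <ᵇ a) ∧ (b <ᵇ c)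

stat : Stat → List ℕ → ℕ
stat st (a ∷ b ∷ c ∷ w) =
  (if counts st a b c then 1 else 0) + stat st (b ∷ c ∷ w)
stat st _ = 0

-- Generating polynomial g^st_n(a_1 ⋯ a_k) = Σ q^{st(Flatten π)} over π ∈ S_n
-- with Flatten(π) beginning with a_1 ⋯ a_k, represented by its coefficient
-- list [c_0 , c_1 , … , c_n], where c_k = #{π : prefix ok, st(Flatten π) = k}.
-- (Every statistic is ≤ n, so this list determines the polynomial.)

isPrefix : List ℕ → List ℕ → Bool
isPrefix []       _        = true
isPrefix (x ∷ xs) []       = false
isPrefix (x ∷ xs) (y ∷ ys) = (x ≡ᵇ y) ∧ isPrefix xs ys

count : {A : Set} → (A → Bool) → List A → ℕ
count P []       = 0
count P (x ∷ xs) = (if P x then 1 else 0) + count P xs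

coeff : Stat → ℕ → List ℕ → ℕ → ℕ
coeff st n pre k =
  count (λ π → isPrefix pre (Flatten n π) ∧ (stat st (Flatten n π) ≡ᵇ k)) (Sn n)

g : Stat → ℕ → List ℕ → List ℕ
g st n pre = map (coeff st n pre) (upTo (suc n))

-- Conjugating π by the transposition τ = (K K+1), where j < K, matches the permutations whose
-- flattened word begins 1 (K+1) j with those whose word begins 1 K j.  If Flatten π = 1 a j u with
-- a ∈ {K, K+1}, then a = π(1) lies on the cycle of 1 and occurs nowhere else in the word.  Relabelling
-- by τ keeps 1 the minimum of the first cycle and can only exchange the candidates K and K+1 in the
-- scan for new cycle minima, which is harmless because a is already listed; hence
-- Flatten (τπτ) = τ (Flatten π) letterwise.  As K and K+1 are never adjacent in this word, τ preserves
-- every comparison of consecutive letters, so r, d, p and v are unchanged.  Stepping i down to j+1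
-- gives the theorem.

module Submission where

open import Defs hiding (r; d; p; v)
open import Data.Bool using (Bool; true; false; if_then_else_; T; _∨_; _∧_)
open import Data.Bool.Properties using (T-≡; T-∧)
open import Data.Unit using (tt)
open import Data.List using (List; []; _∷_; _++_; map; concatMap; length; applyUpTo; upTo)
open import Data.List.Properties
  using (∷-injective; ∷-injectiveʳ; map-cong; map-upTo; map-++; length-map; length-upTo; ++-identityʳ; ++-assoc)
open import Data.List.Membership.Propositional using (_∈_; _∉_; find; lose)
open import Data.List.Membership.Propositional.Properties
  using (∈-map⁺; ∈-map⁻; ∈-++⁺ˡ; ∈-++⁻; ∈-∃++; ∈-concatMap⁺; ∈-concatMap⁻; ∈-upTo⁻)
open import Data.List.Relation.Unary.Any as Any using (here; there)
open import Data.List.Relation.Unary.Any.Properties using (any⁺; any⁻)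
open import Data.List.Relation.Unary.All as All using (All; []; _∷_)
open import Data.List.Relation.Unary.AllPairs using ([]; _∷_)
open import Data.List.Relation.Unary.Linked using (Linked; []; [-]; _∷_)
open import Data.List.Relation.Unary.Unique.Propositional using (Unique)
import Data.List.Relation.Unary.Unique.Propositional.Properties as Unique
open import Data.List.Relation.Binary.Disjoint.Propositional using (Disjoint)
open import Data.List.Relation.Binary.Permutation.Propositional as ↭
  using (_↭_; refl; prep; swap; ↭-sym; ↭-trans; ↭⇒↭ₛ)
import Data.List.Relation.Binary.Permutation.Setoid.Properties as PermutationSetoid
open import Data.List.Relation.Binary.Permutation.Propositional.Properties
  using (∈-resp-↭; drop-mid; ↭-length; ++⁺ˡ) renaming (map⁺ to ↭-map⁺)
open import Data.List.Relation.Binary.BagAndSetEquality using (∼bag⇒↭)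
open import Data.List.Membership.Propositional.Properties.WithK using (unique∧set⇒bag)
open import Data.Nat using (ℕ; zero; suc; pred; _≟_; _+_; _≤_; _<_; _<ᵇ_; _≡ᵇ_; z≤n; s≤s; z<s)
open import Data.Nat.Properties
  using (+-assoc; +-comm; +-identityʳ; +-suc; suc-injective; ≤-refl; ≤-reflexive; ≤-trans; ≤-pred; <⇒≤;
         <-irrefl; <-trans; ≤-<-trans; <-≤-trans; <⇒≢; ≰⇒>; _≤?_; n≤1+n; n<1+n; m≤m+n; m≤n+m; m<m+n;
         m≤n⇒m≤1+n; m<n⇒m<1+n; m≤n⇒m<n∨m≡n; m≤n⇒∃[o]m+o≡n; <ᵇ⇒<; <⇒<ᵇ; ≡ᵇ⇒≡; ≡⇒≡ᵇ)
open import Data.Nat.GeneralisedArithmetic using (iterate)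
open import Data.Fin using (toℕ; fromℕ<)
open import Data.Fin.Properties using (pigeonhole; toℕ-fromℕ<; toℕ<n)
open import Data.Product using (∃; _×_; _,_; proj₁; proj₂; uncurry)
open import Data.Sum as Sum using (_⊎_; inj₁; inj₂)
open import Data.Empty using (⊥-elim)
open import Function.Base using (case_of_; _∘_)
open import Function.Bundles using (mk⇔; Equivalence)
open import Relation.Nullary using (¬_; Dec; yes; no)
open import Relation.Binary.PropositionalEquality
  using (_≡_; _≢_; refl; sym; trans; cong; cong₂; subst; subst₂; setoid; module ≡-Reasoning)

private
  variable
    A B : Set

  module ↭ₛ = PermutationSetoid (setoid ℕ)

-- Enumerating permutations

concatMap-unique : (f : A → List B) (xs : List A) → Unique xs →
  (∀ {y} → y ∈ xs → Unique (f y)) →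
  (∀ {y y′ z} → y ∈ xs → y′ ∈ xs → z ∈ f y → z ∈ f y′ → y ≡ y′) →
  Unique (concatMap f xs)
concatMap-unique f [] _ _ _ = []
concatMap-unique f (x ∷ xs) (x∉xs ∷ u) uf sep =
  Unique.++⁺ (uf (here refl))
    (concatMap-unique f xs u (λ y∈ → uf (there y∈)) (λ y∈ y′∈ → sep (there y∈) (there y′∈)))
    disjoint
  where
  disjoint : Disjoint (f x) (concatMap f xs)
  disjoint (z∈fx , z∈rest) with find (∈-concatMap⁻ f z∈rest)
  ... | y , y∈ , z∈fy = All.lookup x∉xs y∈ (sep (here refl) (there y∈) z∈fx z∈fy)

∈-insertions⇒↭ : ∀ x l {z} → z ∈ insertions x l → z ↭ x ∷ l
∈-insertions⇒↭ x [] (here refl) = refl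
∈-insertions⇒↭ x (y ∷ ys) (here refl) = refl
∈-insertions⇒↭ x (y ∷ ys) (there z∈) with ∈-map⁻ (y ∷_) z∈
... | w , w∈ , refl = ↭-trans (prep y (∈-insertions⇒↭ x ys w∈)) (swap y x refl)

∈-orderings⇒↭ : ∀ L {z} → z ∈ orderings L → z ↭ L
∈-orderings⇒↭ [] (here refl) = refl
∈-orderings⇒↭ (x ∷ xs) z∈ with find (∈-concatMap⁻ (insertions x) z∈)
... | t , t∈ , z∈t = ↭-trans (∈-insertions⇒↭ x t z∈t) (prep x (∈-orderings⇒↭ xs t∈))

insert-∈-insertions : ∀ x (a b : List ℕ) → a ++ x ∷ b ∈ insertions x (a ++ b)
insert-∈-insertions x [] [] = here refl
insert-∈-insertions x [] (y ∷ b) = here refl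
insert-∈-insertions x (y ∷ a) b = there (∈-map⁺ (y ∷_) (insert-∈-insertions x a b))

↭⇒∈-orderings : ∀ L {z} → z ↭ L → z ∈ orderings L
↭⇒∈-orderings [] {[]} _ = here refl
↭⇒∈-orderings [] {_ ∷ _} z↭ with () ← ↭-length z↭
↭⇒∈-orderings (x ∷ xs) z↭ with ∈-∃++ (∈-resp-↭ (↭-sym z↭) (here refl))
... | a , b , refl =
  ∈-concatMap⁺ (insertions x) (lose (↭⇒∈-orderings xs (drop-mid a [] z↭)) (insert-∈-insertions x a b))

delete : ℕ → List ℕ → List ℕ
delete x [] = []
delete x (y ∷ ys) with x ≟ y
... | yes _ = ys
... | no _ = y ∷ delete x ys

delete-head : ∀ x l → delete x (x ∷ l) ≡ l
delete-head x l with x ≟ x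
... | yes _ = refl
... | no x≢x = ⊥-elim (x≢x refl)

delete-insertions : ∀ x l {z} → x ∉ l → z ∈ insertions x l → delete x z ≡ l
delete-insertions x [] _ (here refl) = delete-head x []
delete-insertions x (y ∷ ys) _ (here refl) = delete-head x (y ∷ ys)
delete-insertions x (y ∷ ys) x∉ (there z∈) with ∈-map⁻ (y ∷_) z∈
... | w , w∈ , refl with x ≟ y
...   | yes refl = ⊥-elim (x∉ (here refl))
...   | no _ = cong (y ∷_) (delete-insertions x ys (λ x∈ → x∉ (there x∈)) w∈)

insertions-unique : ∀ x l → x ∉ l → Unique (insertions x l)
insertions-unique x [] _ = [] ∷ []
insertions-unique x (y ∷ ys) x∉ =
  All.tabulate front≢ ∷ Unique.map⁺ ∷-injectiveʳ (insertions-unique x ys (λ x∈ → x∉ (there x∈)))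
  where
  front≢ : ∀ {z} → z ∈ map (y ∷_) (insertions x ys) → x ∷ y ∷ ys ≢ z
  front≢ z∈ eq with ∈-map⁻ (y ∷_) z∈
  front≢ z∈ refl | _ , _ , refl = x∉ (here refl)

orderings-unique : ∀ L → Unique L → Unique (orderings L)
orderings-unique [] _ = [] ∷ []
orderings-unique (x ∷ xs) (x∉xs ∷ u) =
  concatMap-unique (insertions x) (orderings xs) (orderings-unique xs u)
    (λ t∈ → insertions-unique x _ (x∉ t∈))
    (λ {t} {t′} t∈ t′∈ z∈ z∈′ →
      trans (sym (delete-insertions x t (x∉ t∈) z∈)) (delete-insertions x t′ (x∉ t′∈) z∈′))
  where
  x∉ : ∀ {t} → t ∈ orderings xs → x ∉ t
  x∉ t∈ x∈ = All.lookup x∉xs (∈-resp-↭ (∈-orderings⇒↭ xs t∈) x∈) refl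

Unique-resp-↭ : ∀ {xs ys : List ℕ} → xs ↭ ys → Unique xs → Unique ys
Unique-resp-↭ xs↭ys = ↭ₛ.Unique-resp-↭ (↭⇒↭ₛ xs↭ys)

count-↭ : (P : A → Bool) {xs ys : List A} → xs ↭ ys → count P xs ≡ count P ys
count-↭ P refl = refl
count-↭ P (prep x xs↭ys) = cong (_ +_) (count-↭ P xs↭ys)
count-↭ P (swap {xs} {ys} x y xs↭ys) = begin
  a + (b + count P xs)  ≡⟨ +-assoc a b _ ⟨
  a + b + count P xs    ≡⟨ cong₂ _+_ (+-comm a b) (count-↭ P xs↭ys) ⟩
  b + a + count P ys    ≡⟨ +-assoc b a _ ⟩
  b + (a + count P ys)  ∎
  where
  open ≡-Reasoning
  a = if P x then 1 else 0
  b = if P y then 1 else 0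
count-↭ P (↭.trans p q) = trans (count-↭ P p) (count-↭ P q)

count-map : (P : B → Bool) (f : A → B) (xs : List A) → count P (map f xs) ≡ count (λ x → P (f x)) xs
count-map P f [] = refl
count-map P f (x ∷ xs) = cong (_ +_) (count-map P f xs)

count-cong : (P Q : A → Bool) (xs : List A) → (∀ {x} → x ∈ xs → P x ≡ Q x) → count P xs ≡ count Q xs
count-cong P Q [] _ = refl
count-cong P Q (x ∷ xs) P≗Q =
  cong₂ _+_ (cong (λ b → if b then 1 else 0) (P≗Q (here refl))) (count-cong P Q xs (λ x∈ → P≗Q (there x∈)))

count-orderings-involution : (f : List ℕ → List ℕ) (L : List ℕ) → Unique L →
  (∀ x → f (f x) ≡ x) → (∀ {x} → x ↭ L → f x ↭ L) →
  (P Q : List ℕ → Bool) → (∀ {x} → x ↭ L → P x ≡ Q (f x)) →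
  count P (orderings L) ≡ count Q (orderings L)
count-orderings-involution f L uL f-invol f-↭ P Q P≗Q∘f = begin
  count P (orderings L)             ≡⟨ count-cong P (λ x → Q (f x)) _ (λ x∈ → P≗Q∘f (∈-orderings⇒↭ L x∈)) ⟩
  count (λ x → Q (f x)) (orderings L) ≡⟨ count-map Q f (orderings L) ⟨
  count Q (map f (orderings L))     ≡⟨ count-↭ Q map-f-↭ ⟩
  count Q (orderings L)             ∎
  where
  open ≡-Reasoning
  f-injective : ∀ {x y} → f x ≡ f y → x ≡ y
  f-injective {x} {y} fx≡fy = trans (sym (f-invol x)) (trans (cong f fx≡fy) (f-invol y))
  map-f-↭ : map f (orderings L) ↭ orderings L
  map-f-↭ = ∼bag⇒↭ (unique∧set⇒bag
    (Unique.map⁺ f-injective (orderings-unique L uL)) (orderings-unique L uL) (mk⇔ to from))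
    where
    to : ∀ {x} → x ∈ map f (orderings L) → x ∈ orderings L
    to x∈ with ∈-map⁻ f x∈
    ... | y , y∈ , refl = ↭⇒∈-orderings L (f-↭ (∈-orderings⇒↭ L y∈))
    from : ∀ {x} → x ∈ orderings L → x ∈ map f (orderings L)
    from {x} x∈ = subst (_∈ map f (orderings L)) (f-invol x)
      (∈-map⁺ f (↭⇒∈-orderings L (f-↭ (∈-orderings⇒↭ L x∈))))

interval : ℕ → ℕ → List ℕ
interval lo zero = []
interval lo (suc c) = lo ∷ interval (suc lo) c

applyUpTo≡interval : ∀ (f : ℕ → ℕ) lo n → (∀ i → f i ≡ lo + i) → applyUpTo f n ≡ interval lo n
applyUpTo≡interval f lo zero _ = refl
applyUpTo≡interval f lo (suc n) f≗lo+ = cong₂ _∷_ (trans (f≗lo+ 0) (+-identityʳ lo))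
  (applyUpTo≡interval (λ i → f (suc i)) (suc lo) n (λ i → trans (f≗lo+ (suc i)) (+-suc lo i)))

range1≡interval : ∀ n → range1 n ≡ interval 1 n
range1≡interval n = trans (map-upTo suc n) (applyUpTo≡interval suc 1 n (λ _ → refl))

∈-interval⁻ : ∀ lo c {z} → z ∈ interval lo c → lo ≤ z × z < lo + c
∈-interval⁻ lo (suc c) (here refl) = ≤-refl , m<m+n lo z<s
∈-interval⁻ lo (suc c) {z} (there z∈) with ∈-interval⁻ (suc lo) c z∈
... | lo<z , z<1+lo+c = <⇒≤ lo<z , subst (z <_) (sym (+-suc lo c)) z<1+lo+c

interval-++ : ∀ lo a b → interval lo (a + b) ≡ interval lo a ++ interval (lo + a) b
interval-++ lo zero b = cong (λ t → interval t b) (sym (+-identityʳ lo))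
interval-++ lo (suc a) b =
  cong (lo ∷_) (trans (interval-++ (suc lo) a b) (cong (λ t → interval (suc lo) a ++ interval t b) (sym (+-suc lo a))))

range1-unique : ∀ n → Unique (range1 n)
range1-unique n = Unique.map⁺ suc-injective (Unique.upTo⁺ n)

length-range1 : ∀ n → length (range1 n) ≡ n
length-range1 n = trans (length-map suc (upTo n)) (length-upTo n)

∈-range1⁻ : ∀ {n z} → z ∈ range1 n → 1 ≤ z × z ≤ n
∈-range1⁻ z∈ with ∈-map⁻ suc z∈
... | i , i∈ , refl = s≤s z≤n , ∈-upTo⁻ i∈

τ : ℕ → ℕ → ℕ
τ zero zero = 1
τ zero (suc zero) = 0
τ zero x = x
τ (suc k) zero = zero
τ (suc k) (suc x) = suc (τ k x)

τ-involutive : ∀ k x → τ k (τ k x) ≡ x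
τ-involutive zero zero = refl
τ-involutive zero (suc zero) = refl
τ-involutive zero (suc (suc x)) = refl
τ-involutive (suc k) zero = refl
τ-involutive (suc k) (suc x) = cong suc (τ-involutive k x)

τ-injective : ∀ k {x y} → τ k x ≡ τ k y → x ≡ y
τ-injective k {x} {y} eq = trans (sym (τ-involutive k x)) (trans (cong (τ k) eq) (τ-involutive k y))

τ-fixes : ∀ k x → x ≢ k → x ≢ suc k → τ k x ≡ x
τ-fixes zero zero x≢0 _ = ⊥-elim (x≢0 refl)
τ-fixes zero (suc zero) _ x≢1 = ⊥-elim (x≢1 refl)
τ-fixes zero (suc (suc x)) _ _ = refl
τ-fixes (suc k) zero _ _ = refl
τ-fixes (suc k) (suc x) x≢k x≢1+k =
  cong suc (τ-fixes k x (λ eq → x≢k (cong suc eq)) (λ eq → x≢1+k (cong suc eq)))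

τ-left : ∀ k → τ k k ≡ suc k
τ-left zero = refl
τ-left (suc k) = cong suc (τ-left k)

τ-right : ∀ k → τ k (suc k) ≡ k
τ-right zero = refl
τ-right (suc k) = cong suc (τ-right k)

map-τ-involutive : ∀ k l → map (τ k) (map (τ k) l) ≡ l
map-τ-involutive k [] = refl
map-τ-involutive k (x ∷ l) = cong₂ _∷_ (τ-involutive k x) (map-τ-involutive k l)

map-τ-fixes : ∀ k l → (∀ {z} → z ∈ l → z ≢ k × z ≢ suc k) → map (τ k) l ≡ l
map-τ-fixes k [] _ = refl
map-τ-fixes k (x ∷ l) away =
  cong₂ _∷_ (uncurry (τ-fixes k x) (away (here refl))) (map-τ-fixes k l (λ z∈ → away (there z∈)))

-- Exchanges the entries at (1-based) positions k and k+1.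
swapAt : ℕ → List ℕ → List ℕ
swapAt (suc zero) (a ∷ b ∷ l) = b ∷ a ∷ l
swapAt (suc (suc k)) (a ∷ l) = a ∷ swapAt (suc k) l
swapAt _ l = l

apply-swapAt : ∀ k l x → suc (suc k) ≤ length l → apply (swapAt (suc k) l) x ≡ apply l (τ (suc k) x)
apply-swapAt zero (a ∷ []) x (s≤s ())
apply-swapAt zero (a ∷ b ∷ l) zero _ = refl
apply-swapAt zero (a ∷ b ∷ l) (suc zero) _ = refl
apply-swapAt zero (a ∷ b ∷ l) (suc (suc zero)) _ = refl
apply-swapAt zero (a ∷ b ∷ l) (suc (suc (suc x))) _ = refl
apply-swapAt (suc k) (a ∷ l) zero _ = refl
apply-swapAt (suc k) (a ∷ l) (suc zero) _ = refl
apply-swapAt (suc k) (a ∷ l) (suc (suc x)) (s≤s 2+k≤len) = apply-swapAt k l (suc x) 2+k≤len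

apply-map : ∀ (h : ℕ → ℕ) l x → h 0 ≡ 0 → apply (map h l) x ≡ h (apply l x)
apply-map h [] x h0≡0 = sym h0≡0
apply-map h (a ∷ l) zero h0≡0 = sym h0≡0
apply-map h (a ∷ l) (suc zero) _ = refl
apply-map h (a ∷ l) (suc (suc x)) h0≡0 = apply-map h l (suc x) h0≡0

swapAt-map : ∀ (h : ℕ → ℕ) k l → swapAt k (map h l) ≡ map h (swapAt k l)
swapAt-map h zero l = refl
swapAt-map h (suc zero) [] = refl
swapAt-map h (suc zero) (a ∷ []) = refl
swapAt-map h (suc zero) (a ∷ b ∷ l) = refl
swapAt-map h (suc (suc k)) [] = refl
swapAt-map h (suc (suc k)) (a ∷ l) = cong (h a ∷_) (swapAt-map h (suc k) l)

swapAt-involutive : ∀ k l → swapAt k (swapAt k l) ≡ l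
swapAt-involutive zero l = refl
swapAt-involutive (suc zero) [] = refl
swapAt-involutive (suc zero) (a ∷ []) = refl
swapAt-involutive (suc zero) (a ∷ b ∷ l) = refl
swapAt-involutive (suc (suc k)) [] = refl
swapAt-involutive (suc (suc k)) (a ∷ l) = cong (a ∷_) (swapAt-involutive (suc k) l)

swapAt-↭ : ∀ k l → swapAt k l ↭ l
swapAt-↭ zero l = refl
swapAt-↭ (suc zero) [] = refl
swapAt-↭ (suc zero) (a ∷ []) = refl
swapAt-↭ (suc zero) (a ∷ b ∷ l) = swap b a refl
swapAt-↭ (suc (suc k)) [] = refl
swapAt-↭ (suc (suc k)) (a ∷ l) = prep a (swapAt-↭ (suc k) l)

T-injective : ∀ {b c} → (T b → T c) → (T c → T b) → b ≡ c
T-injective {false} {false} _ _ = refl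
T-injective {false} {true} _ c⇒b = ⊥-elim (c⇒b tt)
T-injective {true} {false} b⇒c _ = ⊥-elim (b⇒c tt)
T-injective {true} {true} _ _ = refl

-- {x , y} ≠ {k , k+1}: the pairs whose relative order τ k preserves.
NotTransposed : ℕ → ℕ → ℕ → Set
NotTransposed k x y = (x ≡ k → y ≢ suc k) × (x ≡ suc k → y ≢ k)

NotTransposed-sym : ∀ {k x y} → NotTransposed k x y → NotTransposed k y x
NotTransposed-sym (k,1+k , 1+k,k) = (λ y≡k x≡1+k → 1+k,k x≡1+k y≡k) , (λ y≡1+k x≡k → k,1+k x≡k y≡1+k)

NotTransposed-τ : ∀ {k x y} → NotTransposed k x y → NotTransposed k (τ k x) (τ k y)
NotTransposed-τ {k} (k,1+k , 1+k,k) =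
  (λ τx≡k τy≡1+k → 1+k,k (τ-injective k (trans τx≡k (sym (τ-right k))))
                         (τ-injective k (trans τy≡1+k (sym (τ-left k))))) ,
  (λ τx≡1+k τy≡k → k,1+k (τ-injective k (trans τx≡1+k (sym (τ-left k))))
                         (τ-injective k (trans τy≡k (sym (τ-right k)))))

τ-mono-< : ∀ k {x y} → NotTransposed k x y → x < y → τ k x < τ k y
τ-mono-< zero {zero} {suc zero} (k,1+k , _) _ = ⊥-elim (k,1+k refl refl)
τ-mono-< zero {zero} {suc (suc y)} _ _ = s≤s (s≤s z≤n)
τ-mono-< zero {suc zero} {suc (suc y)} _ _ = s≤s z≤n
τ-mono-< zero {suc (suc x)} {suc (suc y)} _ x<y = x<y
τ-mono-< zero {suc zero} {suc zero} _ (s≤s ())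
τ-mono-< zero {suc (suc x)} {suc zero} _ (s≤s ())
τ-mono-< (suc k) {zero} {suc y} _ _ = s≤s z≤n
τ-mono-< (suc k) {suc x} {suc y} (k,1+k , 1+k,k) (s≤s x<y) =
  s≤s (τ-mono-< k ((λ x≡k y≡1+k → k,1+k (cong suc x≡k) (cong suc y≡1+k)) ,
                   (λ x≡1+k y≡k → 1+k,k (cong suc x≡1+k) (cong suc y≡k))) x<y)

τ-<ᵇ : ∀ k {x y} → NotTransposed k x y → (τ k x <ᵇ τ k y) ≡ (x <ᵇ y)
τ-<ᵇ k {x} {y} xy = T-injective
  (λ τx<τy → <⇒<ᵇ (subst₂ _<_ (τ-involutive k x) (τ-involutive k y)
                    (τ-mono-< k (NotTransposed-τ xy) (<ᵇ⇒< _ _ τx<τy))))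
  (λ x<y → <⇒<ᵇ (τ-mono-< k xy (<ᵇ⇒< x y x<y)))

counts-τ : ∀ k st {a b c} → NotTransposed k a b → NotTransposed k b c →
  counts st (τ k a) (τ k b) (τ k c) ≡ counts st a b c
counts-τ k Stat.r ab bc rewrite τ-<ᵇ k ab | τ-<ᵇ k bc = refl
counts-τ k Stat.d ab bc rewrite τ-<ᵇ k (NotTransposed-sym ab) | τ-<ᵇ k (NotTransposed-sym bc) = refl
counts-τ k Stat.p ab bc rewrite τ-<ᵇ k ab | τ-<ᵇ k (NotTransposed-sym bc) = refl
counts-τ k Stat.v ab bc rewrite τ-<ᵇ k (NotTransposed-sym ab) | τ-<ᵇ k bc = refl

stat-map-τ : ∀ k st w → Linked (NotTransposed k) w → stat st (map (τ k) w) ≡ stat st w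
stat-map-τ k st [] _ = refl
stat-map-τ k st (a ∷ []) _ = refl
stat-map-τ k st (a ∷ b ∷ []) _ = refl
stat-map-τ k st (a ∷ b ∷ c ∷ w) (ab ∷ bc ∷ rest) =
  cong₂ _+_ (cong (λ t → if t then 1 else 0) (counts-τ k st ab bc)) (stat-map-τ k st (b ∷ c ∷ w) (bc ∷ rest))

Linked-NotTransposed : ∀ k a l → (a ≡ k ⊎ a ≡ suc k) → a ∉ l → Linked (NotTransposed k) l
Linked-NotTransposed k a [] _ _ = []
Linked-NotTransposed k a (x ∷ []) _ _ = [-]
Linked-NotTransposed k a (x ∷ y ∷ l) a∈ a∉ =
  (pair a∈ , pair (Sum.swap a∈)) ∷ Linked-NotTransposed k a (y ∷ l) a∈ (λ a∈l → a∉ (there a∈l))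
  where
  pair : ∀ {k′ k″} → (a ≡ k′ ⊎ a ≡ k″) → x ≡ k′ → y ≢ k″
  pair (inj₁ refl) refl _ = a∉ (here refl)
  pair (inj₂ refl) _ refl = a∉ (there (here refl))

-- Standard cycle form

∈⇒elem : ∀ {x l} → x ∈ l → elem x l ≡ true
∈⇒elem {x} x∈ = Equivalence.to T-≡ (any⁺ (x ≡ᵇ_) (Any.map (≡⇒≡ᵇ _ _) x∈))

elem⇒∈ : ∀ {x} l → elem x l ≡ true → x ∈ l
elem⇒∈ {x} l elem≡true = Any.map (≡ᵇ⇒≡ _ _) (any⁻ (x ≡ᵇ_) l (Equivalence.from T-≡ elem≡true))

elem-++⁺ˡ : ∀ {x} l t → elem x l ≡ true → elem x (l ++ t) ≡ true
elem-++⁺ˡ {x} l t x∈l = ∈⇒elem {x} (∈-++⁺ˡ (elem⇒∈ l x∈l))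

module _ (π : List ℕ) (n : ℕ) where

  newCycles : List ℕ → List ℕ → List ℕ
  newCycles seen [] = []
  newCycles seen (m ∷ ms) =
    if elem m seen then newCycles seen ms
    else cycleFrom π n m m ++ newCycles (seen ++ cycleFrom π n m m) ms

  flattenAux≡ : ∀ seen ms → flattenAux π n seen ms ≡ seen ++ newCycles seen ms
  flattenAux≡ seen [] = sym (++-identityʳ seen)
  flattenAux≡ seen (m ∷ ms) with elem m seen
  ... | true = flattenAux≡ seen ms
  ... | false = trans (flattenAux≡ (seen ++ cycleFrom π n m m) ms) (++-assoc seen _ _)

  -- An already listed candidate is skipped wherever it occurs.
  flattenAux-swap : ∀ xs seen b c ys → elem c seen ≡ true →
    flattenAux π n seen (xs ++ b ∷ c ∷ ys) ≡ flattenAux π n seen (xs ++ c ∷ b ∷ ys)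
  flattenAux-swap [] seen b c ys c∈ with elem b seen
  ... | true rewrite c∈ = refl
  ... | false rewrite c∈ | elem-++⁺ˡ {c} seen (cycleFrom π n b b) c∈ = refl
  flattenAux-swap (x ∷ xs) seen b c ys c∈ with elem x seen
  ... | true = flattenAux-swap xs seen b c ys c∈
  ... | false = flattenAux-swap xs (seen ++ cycleFrom π n x x) b c ys (elem-++⁺ˡ {c} seen _ c∈)

-- Relabelling by an involution h: the cycles of h ∘ π ∘ h are the images of those of π.
module Relabel (h : ℕ → ℕ) (h-involutive : ∀ x → h (h x) ≡ x)
               (σ π : List ℕ) (n : ℕ) (apply-σ : ∀ x → apply σ (h x) ≡ h (apply π x)) where

  h-injective : ∀ {x y} → h x ≡ h y → x ≡ y
  h-injective {x} {y} hx≡hy = trans (sym (h-involutive x)) (trans (cong h hx≡hy) (h-involutive y))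

  ≡ᵇ-h : ∀ a b → (h a ≡ᵇ h b) ≡ (a ≡ᵇ b)
  ≡ᵇ-h a b = T-injective (λ ha≡hb → ≡⇒≡ᵇ a b (h-injective (≡ᵇ⇒≡ _ _ ha≡hb)))
                         (λ a≡b → ≡⇒≡ᵇ _ _ (cong h (≡ᵇ⇒≡ a b a≡b)))

  elem-map : ∀ m l → elem m (map h l) ≡ elem (h m) l
  elem-map m [] = refl
  elem-map m (y ∷ l) =
    cong₂ _∨_ (trans (sym (≡ᵇ-h m (h y))) (cong (h m ≡ᵇ_) (h-involutive y))) (elem-map m l)

  cycleFrom-relabel : ∀ fuel m x → cycleFrom σ fuel (h m) (h x) ≡ map h (cycleFrom π fuel m x)
  cycleFrom-relabel zero m x = refl
  cycleFrom-relabel (suc fuel) m x rewrite apply-σ x | ≡ᵇ-h (apply π x) m with apply π x ≡ᵇ m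
  ... | true = refl
  ... | false = cong (h x ∷_) (cycleFrom-relabel fuel m (apply π x))

  cycleFrom-relabel′ : ∀ m → cycleFrom σ n m m ≡ map h (cycleFrom π n (h m) (h m))
  cycleFrom-relabel′ m =
    subst (λ t → cycleFrom σ n t t ≡ map h (cycleFrom π n (h m) (h m))) (h-involutive m)
      (cycleFrom-relabel n (h m) (h m))

  flattenAux-relabel : ∀ seen ms →
    flattenAux σ n (map h seen) ms ≡ map h (flattenAux π n seen (map h ms))
  flattenAux-relabel seen [] = refl
  flattenAux-relabel seen (m ∷ ms) rewrite elem-map m seen with elem (h m) seen
  ... | true = flattenAux-relabel seen ms
  ... | false = trans
    (cong (λ t → flattenAux σ n t ms)
      (trans (cong (map h seen ++_) (cycleFrom-relabel′ m)) (sym (map-++ h seen _))))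
    (flattenAux-relabel (seen ++ cycleFrom π n (h m) (h m)) ms)

-- Orbits

module _ {P : ℕ → Set} (P? : ∀ k → Dec (P k)) where

  private
    Least : ℕ → ℕ → Set
    Least n m = m ≤ n × P m × (∀ k → k < m → ¬ P k)

    search : ∀ n → (∃ λ m → Least n m) ⊎ (∀ k → k ≤ n → ¬ P k)
    search zero with P? 0
    ... | yes p0 = inj₁ (0 , z≤n , p0 , λ _ ())
    ... | no ¬p0 = inj₂ λ { zero _ → ¬p0 }
    search (suc n) with search n
    ... | inj₁ (m , m≤n , pm , below) = inj₁ (m , m≤n⇒m≤1+n m≤n , pm , below)
    ... | inj₂ none with P? (suc n)
    ...   | yes p = inj₁ (suc n , ≤-refl , p , λ k k<1+n → none k (≤-pred k<1+n))
    ...   | no ¬p = inj₂ λ k k≤1+n → Sum.[ (λ k<1+n → none k (≤-pred k<1+n)) , (λ { refl → ¬p }) ]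
                                        (m≤n⇒m<n∨m≡n k≤1+n)

  least-witness : ∀ {n} → P n → ∃ λ m → m ≤ n × P m × (∀ k → k < m → ¬ P k)
  least-witness {n} pn with search n
  ... | inj₁ found = found
  ... | inj₂ none = ⊥-elim (none n ≤-refl pn)

module _ {A : Set} (f : A → A) where

  iterate-+ : ∀ a b x → iterate f x (a + b) ≡ iterate f (iterate f x a) b
  iterate-+ zero b x = refl
  iterate-+ (suc a) b x = iterate-+ a b (f x)

  iterate-comm : ∀ a b x → iterate f (iterate f x b) a ≡ iterate f (iterate f x a) b
  iterate-comm a b x = begin
    iterate f (iterate f x b) a  ≡⟨ iterate-+ b a x ⟨
    iterate f x (b + a)          ≡⟨ cong (iterate f x) (+-comm b a) ⟩
    iterate f x (a + b)          ≡⟨ iterate-+ a b x ⟩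
    iterate f (iterate f x a) b  ∎
    where open ≡-Reasoning

  iterate-suc : ∀ t x → iterate f x (suc t) ≡ f (iterate f x t)
  iterate-suc t x = sym (iterate-comm 1 t x)

apply-∈ : ∀ l x → 1 ≤ x → x ≤ length l → apply l x ∈ l
apply-∈ (b ∷ l) (suc zero) _ _ = here refl
apply-∈ (b ∷ l) (suc (suc x)) _ (s≤s x<len) = there (apply-∈ l (suc x) (s≤s z≤n) x<len)

apply-injective : ∀ l {x y} → Unique l → 1 ≤ x → x ≤ length l → 1 ≤ y → y ≤ length l →
  apply l x ≡ apply l y → x ≡ y
apply-injective (b ∷ l) {suc zero} {suc zero} _ _ _ _ _ _ = refl
apply-injective (b ∷ l) {suc zero} {suc (suc y)} (b∉l ∷ _) _ _ _ (s≤s y<len) b≡ly =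
  ⊥-elim (All.lookup b∉l (apply-∈ l (suc y) (s≤s z≤n) y<len) b≡ly)
apply-injective (b ∷ l) {suc (suc x)} {suc zero} (b∉l ∷ _) _ (s≤s x<len) _ _ lx≡b =
  ⊥-elim (All.lookup b∉l (apply-∈ l (suc x) (s≤s z≤n) x<len) (sym lx≡b))
apply-injective (b ∷ l) {suc (suc x)} {suc (suc y)} (_ ∷ u) _ (s≤s x<len) _ (s≤s y<len) lx≡ly =
  cong suc (apply-injective l u (s≤s z≤n) x<len (s≤s z≤n) y<len lx≡ly)

module Orbit (n : ℕ) (π : List ℕ) (π↭ : π ↭ range1 (suc (suc n))) where

  N : ℕ
  N = suc (suc n)

  F : ℕ → ℕ
  F = apply π

  F^ : ℕ → ℕ → ℕ
  F^ t x = iterate F x t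

  Good : ℕ → Set
  Good x = 1 ≤ x × x ≤ N

  length-π : length π ≡ N
  length-π = trans (↭-length π↭) (length-range1 N)

  F-Good : ∀ {x} → Good x → Good (F x)
  F-Good (1≤x , x≤N) = ∈-range1⁻ (∈-resp-↭ π↭ (apply-∈ π _ 1≤x (subst (_ ≤_) (sym length-π) x≤N)))

  F-injective : ∀ {x y} → Good x → Good y → F x ≡ F y → x ≡ y
  F-injective (1≤x , x≤N) (1≤y , y≤N) =
    apply-injective π (Unique-resp-↭ (↭-sym π↭) (range1-unique N))
      1≤x (subst (_ ≤_) (sym length-π) x≤N) 1≤y (subst (_ ≤_) (sym length-π) y≤N)

  F^-Good : ∀ t {x} → Good x → Good (F^ t x)
  F^-Good zero gx = gx
  F^-Good (suc t) gx = F^-Good t (F-Good gx)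

  F^-injective : ∀ t {x y} → Good x → Good y → F^ t x ≡ F^ t y → x ≡ y
  F^-injective zero _ _ eq = eq
  F^-injective (suc t) gx gy eq = F-injective gx gy (F^-injective t (F-Good gx) (F-Good gy) eq)

  ∈-cycleFrom⁻ : ∀ fuel m x {z} → z ∈ cycleFrom π fuel m x →
    ∃ λ t → z ≡ F^ t x × (∀ s → s < t → F^ (suc s) x ≢ m)
  ∈-cycleFrom⁻ (suc fuel) m x (here refl) = 0 , refl , λ _ ()
  ∈-cycleFrom⁻ (suc fuel) m x (there z∈) with F x ≡ᵇ m in Fx≡ᵇm
  ... | false with ∈-cycleFrom⁻ fuel m (F x) z∈
  ...   | t , refl , no-return = suc t , refl , λ
    { zero _ Fx≡m → subst T Fx≡ᵇm (≡⇒≡ᵇ _ _ Fx≡m)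
    ; (suc s) (s≤s s<t) → no-return s s<t }

  ∈-cycleFrom⁺ : ∀ fuel m x t → t < fuel → (∀ s → s < t → F^ (suc s) x ≢ m) →
    F^ t x ∈ cycleFrom π fuel m x
  ∈-cycleFrom⁺ (suc fuel) m x zero _ _ = here refl
  ∈-cycleFrom⁺ (suc fuel) m x (suc t) (s≤s t<fuel) no-return with F x ≡ᵇ m in Fx≡ᵇm
  ... | true = ⊥-elim (no-return 0 z<s (≡ᵇ⇒≡ _ _ (subst T (sym Fx≡ᵇm) tt)))
  ... | false = there (∈-cycleFrom⁺ fuel m (F x) t t<fuel (λ s s<t → no-return (suc s) (s≤s s<t)))

  cycleFrom-stop : ∀ fuel m x → F x ≡ m → cycleFrom π (suc fuel) m x ≡ x ∷ []
  cycleFrom-stop fuel m x Fx≡m with F x ≡ᵇ m in Fx≡ᵇm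
  ... | true = refl
  ... | false = ⊥-elim (subst T Fx≡ᵇm (≡⇒≡ᵇ _ _ Fx≡m))

  cycleFrom-continue : ∀ fuel m x → F x ≢ m → cycleFrom π (suc fuel) m x ≡ x ∷ cycleFrom π fuel m (F x)
  cycleFrom-continue fuel m x Fx≢m with F x ≡ᵇ m in Fx≡ᵇm
  ... | true = ⊥-elim (Fx≢m (≡ᵇ⇒≡ _ _ (subst T (sym Fx≡ᵇm) tt)))
  ... | false = refl

  Good-1 : Good 1
  Good-1 = s≤s z≤n , s≤s z≤n

  pred< : ∀ {x} → Good x → pred x < N
  pred< {suc x} (_ , x<N) = x<N

  pred-injective : ∀ {x y} → Good x → Good y → pred x ≡ pred y → x ≡ y
  pred-injective {suc x} {suc y} _ _ = cong suc

  -- Kept opaque: unfolding the pigeonhole witness makes later type checking blow up.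
  opaque
    returns-to-1 : ∃ λ d → d < N × F^ (suc d) 1 ≡ 1
    returns-to-1 with pigeonhole (n<1+n N) (λ t → fromℕ< (pred< (F^-Good (toℕ t) Good-1)))
    ... | i , j , i<j , same with m≤n⇒∃[o]m+o≡n i<j
    ... | d , 1+i+d≡j = d , d<N , F^-injective (toℕ i) (F^-Good (suc d) Good-1) Good-1 (begin
      F^ (toℕ i) (F^ (suc d) 1)  ≡⟨ iterate-+ F (suc d) (toℕ i) 1 ⟨
      F^ (suc d + toℕ i) 1       ≡⟨ cong (λ t → F^ t 1) (trans (cong suc (+-comm d (toℕ i))) 1+i+d≡j) ⟩
      F^ (toℕ j) 1               ≡⟨ pred-injective (F^-Good (toℕ j) Good-1) (F^-Good (toℕ i) Good-1) (begin
        pred (F^ (toℕ j) 1)         ≡⟨ toℕ-fromℕ< _ ⟨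
        toℕ (fromℕ< _)              ≡⟨ cong toℕ same ⟨
        toℕ (fromℕ< _)              ≡⟨ toℕ-fromℕ< _ ⟩
        pred (F^ (toℕ i) 1)         ∎) ⟩
      F^ (toℕ i) 1               ∎)
      where
      open ≡-Reasoning
      d<N : d < N
      d<N = ≤-trans (s≤s (m≤n+m d (toℕ i))) (≤-trans (≤-reflexive 1+i+d≡j) (≤-pred (toℕ<n j)))

  period : ∃ λ p → p < N × F^ (suc p) 1 ≡ 1 × (∀ s → s < p → F^ (suc s) 1 ≢ 1)
  period with returns-to-1
  ... | d , d<N , returns with least-witness (λ s → F^ (suc s) 1 ≟ 1) returns
  ...   | p , p≤d , returns′ , earlier = p , ≤-<-trans p≤d d<N , returns′ , earlier

  p : ℕ
  p = proj₁ period

  p<N : p < N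
  p<N = proj₁ (proj₂ period)

  F^1+p≡1 : F^ (suc p) 1 ≡ 1
  F^1+p≡1 = proj₁ (proj₂ (proj₂ period))

  p-minimal : ∀ s → s < p → F^ (suc s) 1 ≢ 1
  p-minimal = proj₂ (proj₂ (proj₂ period))

  C1 : List ℕ
  C1 = cycleFrom π N 1 1

  F^-∈-C1 : ∀ r → r ≤ p → F^ r 1 ∈ C1
  F^-∈-C1 r r≤p = ∈-cycleFrom⁺ N 1 1 r (≤-<-trans r≤p p<N) (λ s s<r → p-minimal s (<-≤-trans s<r r≤p))

  meets-1⇒∈-C1 : ∀ {m} w → Good m → (∀ s → s < w → F^ (suc s) m ≢ m) → F^ w m ≡ 1 → m ∈ C1
  meets-1⇒∈-C1 zero _ _ refl = here refl
  meets-1⇒∈-C1 {m} (suc w) gm no-return F^wm≡1 with p ≤? w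
  ... | yes p≤w = ⊥-elim (no-return p (s≤s p≤w) (F^-injective (suc w) (F^-Good (suc p) gm) gm (begin
    F^ (suc w) (F^ (suc p) m)  ≡⟨ iterate-comm F (suc w) (suc p) m ⟩
    F^ (suc p) (F^ (suc w) m)  ≡⟨ cong (F^ (suc p)) F^wm≡1 ⟩
    F^ (suc p) 1               ≡⟨ F^1+p≡1 ⟩
    1                          ≡⟨ F^wm≡1 ⟨
    F^ (suc w) m               ∎)))
    where open ≡-Reasoning
  ... | no p≰w with m≤n⇒∃[o]m+o≡n (≰⇒> p≰w)
  ...   | o , 1+w+o≡p = subst (_∈ C1) F^r1≡m
                          (F^-∈-C1 (suc o) (subst (suc o ≤_) 1+w+o≡p (s≤s (m≤n+m o w))))
    where
    open ≡-Reasoning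
    F^r1≡m : F^ (suc o) 1 ≡ m
    F^r1≡m = F^-injective (suc w) (F^-Good (suc o) Good-1) gm (begin
      F^ (suc w) (F^ (suc o) 1)  ≡⟨ iterate-comm F (suc w) (suc o) 1 ⟩
      F^ (suc o) (F^ (suc w) 1)  ≡⟨ iterate-+ F (suc w) (suc o) 1 ⟨
      F^ (suc w + suc o) 1       ≡⟨ cong (λ t → F^ (suc t) 1) (trans (+-suc w o) 1+w+o≡p) ⟩
      F^ (suc p) 1               ≡⟨ F^1+p≡1 ⟩
      1                          ≡⟨ F^wm≡1 ⟨
      F^ (suc w) m               ∎)

  module _ (F1≢1 : F 1 ≢ 1) where

    F1∉cycleFrom-F²1 : F (F 1) ≢ 1 → ∀ fuel → F 1 ∉ cycleFrom π fuel 1 (F (F 1))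
    F1∉cycleFrom-F²1 F²1≢1 fuel F1∈ with ∈-cycleFrom⁻ fuel 1 (F (F 1)) F1∈
    ... | t , F1≡ , no-return with F-injective Good-1 (F^-Good (suc t) Good-1) (trans F1≡ (iterate-suc F (suc t) 1))
    ...   | 1≡F^1+t1 with t
    ...     | zero = F1≢1 (sym 1≡F^1+t1)
    ...     | suc zero = F²1≢1 (sym 1≡F^1+t1)
    ...     | suc (suc s) = no-return s (s≤s (n≤1+n s)) (sym 1≡F^1+t1)

    C1-shape : ∃ λ rest → C1 ≡ 1 ∷ F 1 ∷ rest × F 1 ∉ rest
    C1-shape with F (F 1) ≟ 1
    ... | yes F²1≡1 =
      [] ,
      trans (cycleFrom-continue (suc n) 1 1 F1≢1) (cong (1 ∷_) (cycleFrom-stop n 1 (F 1) F²1≡1)) ,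
      λ ()
    ... | no F²1≢1 =
      cycleFrom π n 1 (F (F 1)) ,
      trans (cycleFrom-continue (suc n) 1 1 F1≢1) (cong (1 ∷_) (cycleFrom-continue n 1 (F 1) F²1≢1)) ,
      F1∉cycleFrom-F²1 F²1≢1 n

    F1∈C1 : F 1 ∈ C1
    F1∈C1 with C1-shape
    ... | _ , C1≡ , _ = subst (F 1 ∈_) (sym C1≡) (there (here refl))

    F1∉cycleFrom : ∀ {m} → Good m → m ∉ C1 → F 1 ∉ cycleFrom π N m m
    F1∉cycleFrom {m} gm m∉C1 F1∈ with ∈-cycleFrom⁻ N m m F1∈
    ... | zero , refl , _ = m∉C1 F1∈C1
    ... | suc w , F1≡ , no-return = m∉C1 (meets-1⇒∈-C1 w gm (λ s s<w → no-return s (m<n⇒m<1+n s<w))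
      (sym (F-injective Good-1 (F^-Good w gm) (trans F1≡ (iterate-suc F w m)))))

    F1∉newCycles : ∀ seen ms → (∀ {z} → z ∈ C1 → elem z seen ≡ true) → All Good ms →
      F 1 ∉ newCycles π N seen ms
    F1∉newCycles seen (m ∷ ms) C1⊆seen (gm ∷ gms) F1∈ with elem m seen in m∈?seen
    ... | true = F1∉newCycles seen ms C1⊆seen gms F1∈
    ... | false with ∈-++⁻ (cycleFrom π N m m) F1∈
    ...   | inj₁ F1∈cycle =
      F1∉cycleFrom gm (λ m∈C1 → case trans (sym (C1⊆seen m∈C1)) m∈?seen of λ ()) F1∈cycle
    ...   | inj₂ F1∈later = F1∉newCycles (seen ++ cycleFrom π N m m) ms
                              (λ {z} z∈C1 → elem-++⁺ˡ {z} seen _ (C1⊆seen z∈C1)) gms F1∈later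

  Flatten≡ : Flatten N π ≡ C1 ++ newCycles π N C1 (interval 2 (suc n))
  Flatten≡ = trans (cong (flattenAux π N []) (range1≡interval N)) (flattenAux≡ π N C1 (interval 2 (suc n)))

  -- If π(1) = 1 the word begins 1 2, whence the hypothesis 3 ≤ a.
  Flatten-second : ∀ {a w} → Flatten N π ≡ 1 ∷ a ∷ w → 3 ≤ a → F 1 ≡ a × a ∉ w
  Flatten-second {a} {w} flat 3≤a with F 1 ≟ 1
  ... | yes F1≡1 = ⊥-elim (case a≡2 of λ { refl → case 3≤a of λ { (s≤s (s≤s ())) } })
    where
    a≡2 : a ≡ 2
    a≡2 = proj₁ (∷-injective (proj₂ (∷-injective (trans (sym flat) (trans Flatten≡
            (cong (λ c → c ++ newCycles π N c (interval 2 (suc n))) (cycleFrom-stop (suc n) 1 1 F1≡1)))))))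
  ... | no F1≢1 with C1-shape F1≢1
  ...   | rest , C1≡ , F1∉rest with ∷-injective (proj₂ (∷-injective (trans (sym flat) (trans Flatten≡
            (cong (_++ newCycles π N C1 (interval 2 (suc n))) C1≡)))))
  ...     | refl , refl =
    refl , λ F1∈w → Sum.[ F1∉rest , F1∉newCycles F1≢1 C1 _ ∈⇒elem interval-Good ] (∈-++⁻ rest F1∈w)
    where
    interval-Good : All Good (interval 2 (suc n))
    interval-Good = All.tabulate λ z∈ →
      ≤-trans (s≤s z≤n) (proj₁ (∈-interval⁻ 2 (suc n) z∈)) , ≤-pred (proj₂ (∈-interval⁻ 2 (suc n) z∈))

-- Conjugation by (K K+1)

isPrefix⇒ : ∀ pre w → T (isPrefix pre w) → ∃ λ u → w ≡ pre ++ u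
isPrefix⇒ [] w _ = w , refl
isPrefix⇒ (x ∷ pre) (y ∷ w) prefix with Equivalence.to T-∧ prefix
... | x≡ᵇy , prefix′ with ≡ᵇ⇒≡ x y x≡ᵇy | isPrefix⇒ pre w prefix′
...   | refl | u , refl = u , refl

isPrefix-++ : ∀ pre u → T (isPrefix pre (pre ++ u))
isPrefix-++ [] u = tt
isPrefix-++ (x ∷ pre) u = Equivalence.from T-∧ (≡⇒≡ᵇ x x refl , isPrefix-++ pre u)

NotTransposed-outsideˡ : ∀ {k x y} → x ≢ k → x ≢ suc k → NotTransposed k x y
NotTransposed-outsideˡ x≢k x≢1+k = (λ x≡k → ⊥-elim (x≢k x≡k)) , (λ x≡1+k → ⊥-elim (x≢1+k x≡1+k))

-- Writing K = k + 2 and N = K + 1 + e makes 1 < K < N hold by construction.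
module Conjugation (k e j : ℕ) (2≤j : 2 ≤ j) (j<K : j < suc (suc k)) where

  K N : ℕ
  K = suc (suc k)
  N = suc K + e

  conj : List ℕ → List ℕ
  conj π = map (τ K) (swapAt K π)

  conj-involutive : ∀ π → conj (conj π) ≡ π
  conj-involutive π = begin
    map (τ K) (swapAt K (map (τ K) (swapAt K π)))  ≡⟨ cong (map (τ K)) (swapAt-map (τ K) K (swapAt K π)) ⟩
    map (τ K) (map (τ K) (swapAt K (swapAt K π)))  ≡⟨ map-τ-involutive K _ ⟩
    swapAt K (swapAt K π)                          ≡⟨ swapAt-involutive K π ⟩
    π                                              ∎
    where open ≡-Reasoning

  apply-conj : ∀ π → length π ≡ N → ∀ x → apply (conj π) (τ K x) ≡ τ K (apply π x)
  apply-conj π length-π x = begin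
    apply (map (τ K) (swapAt K π)) (τ K x)  ≡⟨ apply-map (τ K) (swapAt K π) (τ K x) refl ⟩
    τ K (apply (swapAt K π) (τ K x))        ≡⟨ cong (τ K) (apply-swapAt (suc k) π (τ K x) K<length) ⟩
    τ K (apply π (τ K (τ K x)))             ≡⟨ cong (λ y → τ K (apply π y)) (τ-involutive K x) ⟩
    τ K (apply π x)                         ∎
    where
    open ≡-Reasoning
    K<length : suc K ≤ length π
    K<length = subst (suc K ≤_) (sym length-π) (m≤m+n (suc K) e)

  xs ys : List ℕ
  xs = interval 2 k
  ys = interval (suc (suc K)) e

  range1-split : range1 N ≡ 1 ∷ xs ++ K ∷ suc K ∷ ys
  range1-split = trans (range1≡interval N) (cong (1 ∷_) (trans
    (cong (interval 2) (sym (trans (+-suc k (suc e)) (cong suc (+-suc k e))))) (interval-++ 2 k (suc (suc e)))))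

  3≤K : 3 ≤ K
  3≤K = ≤-trans (s≤s 2≤j) j<K

  K-or-1+K⇒3≤ : ∀ {a} → a ≡ K ⊎ a ≡ suc K → 3 ≤ a
  K-or-1+K⇒3≤ (inj₁ refl) = 3≤K
  K-or-1+K⇒3≤ (inj₂ refl) = ≤-trans 3≤K (n≤1+n K)

  map-τ-range1 : map (τ K) (range1 N) ≡ 1 ∷ xs ++ suc K ∷ K ∷ ys
  map-τ-range1 = begin
    map (τ K) (range1 N)                               ≡⟨ cong (map (τ K)) range1-split ⟩
    1 ∷ map (τ K) (xs ++ K ∷ suc K ∷ ys)               ≡⟨ cong (1 ∷_) (map-++ (τ K) xs _) ⟩
    1 ∷ map (τ K) xs ++ map (τ K) (K ∷ suc K ∷ ys)     ≡⟨ cong₂ (λ u v → 1 ∷ u ++ v) xs-fixed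
                                                          (cong₂ _∷_ (τ-left K) (cong₂ _∷_ (τ-right K) ys-fixed)) ⟩
    1 ∷ xs ++ suc K ∷ K ∷ ys                           ∎
    where
    open ≡-Reasoning
    xs-fixed : map (τ K) xs ≡ xs
    xs-fixed = map-τ-fixes K xs λ z∈ → let z<K = proj₂ (∈-interval⁻ 2 k z∈) in
      <⇒≢ z<K , <⇒≢ (m<n⇒m<1+n z<K)
    ys-fixed : map (τ K) ys ≡ ys
    ys-fixed = map-τ-fixes K ys λ z∈ → let 2+K≤z = proj₁ (∈-interval⁻ _ e z∈) in
      (λ z≡K → <-irrefl (sym z≡K) (<-trans (n<1+n K) 2+K≤z)) , (λ z≡1+K → <-irrefl (sym z≡1+K) 2+K≤z)

  conj-↭ : ∀ {π} → π ↭ range1 N → conj π ↭ range1 N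
  conj-↭ {π} π↭ = ↭-trans (↭-map⁺ (τ K) (swapAt-↭ K π)) (↭-trans (↭-map⁺ (τ K) π↭) map-τ-range1-↭)
    where
    map-τ-range1-↭ : map (τ K) (range1 N) ↭ range1 N
    map-τ-range1-↭ = subst₂ _↭_ (sym map-τ-range1) (sym range1-split) (prep 1 (++⁺ˡ xs (swap (suc K) K refl)))

  module _ {π : List ℕ} (π↭ : π ↭ range1 N) where

    open Orbit (suc (k + e)) π π↭ using (F; length-π; C1; F1∈C1; Flatten-second)

    Flatten-conj : F 1 ≡ K ⊎ F 1 ≡ suc K → Flatten N (conj π) ≡ map (τ K) (Flatten N π)
    Flatten-conj F1∈ = begin
      flattenAux (conj π) N [] (range1 N)
        ≡⟨ flattenAux-relabel [] (range1 N) ⟩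
      map (τ K) (flattenAux π N [] (map (τ K) (range1 N)))
        ≡⟨ cong (λ ms → map (τ K) (flattenAux π N [] ms)) map-τ-range1 ⟩
      map (τ K) (flattenAux π N C1 (xs ++ suc K ∷ K ∷ ys))
        ≡⟨ cong (map (τ K)) (swap-candidates F1∈) ⟩
      map (τ K) (flattenAux π N C1 (xs ++ K ∷ suc K ∷ ys))
        ≡⟨ cong (λ ms → map (τ K) (flattenAux π N [] ms)) range1-split ⟨
      map (τ K) (flattenAux π N [] (range1 N))
        ∎
      where
      open ≡-Reasoning
      open Relabel (τ K) (τ-involutive K) (conj π) π N (apply-conj π length-π)
      F1≢1 : F 1 ≢ 1
      F1≢1 F1≡1 = case subst (3 ≤_) F1≡1 (K-or-1+K⇒3≤ F1∈) of λ { (s≤s ()) }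
      swap-candidates : F 1 ≡ K ⊎ F 1 ≡ suc K →
        flattenAux π N C1 (xs ++ suc K ∷ K ∷ ys) ≡ flattenAux π N C1 (xs ++ K ∷ suc K ∷ ys)
      swap-candidates (inj₁ F1≡K) =
        flattenAux-swap π N xs C1 (suc K) K ys (∈⇒elem (subst (_∈ C1) F1≡K (F1∈C1 F1≢1)))
      swap-candidates (inj₂ F1≡1+K) =
        sym (flattenAux-swap π N xs C1 K (suc K) ys (∈⇒elem (subst (_∈ C1) F1≡1+K (F1∈C1 F1≢1))))

  Counted : Stat → ℕ → ℕ → List ℕ → Bool
  Counted st c a π = isPrefix (1 ∷ a ∷ j ∷ []) (Flatten N π) ∧ (stat st (Flatten N π) ≡ᵇ c)

  transfer : ∀ {π} → π ↭ range1 N → ∀ st c a → a ≡ K ⊎ a ≡ suc K →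
    T (Counted st c a π) → T (Counted st c (τ K a) (conj π))
  transfer {π} π↭ st c a a∈ counted with Equivalence.to T-∧ counted
  ... | prefix , stat≡c with isPrefix⇒ (1 ∷ a ∷ j ∷ []) _ prefix
  ... | u , flat with Orbit.Flatten-second (suc (k + e)) π π↭ flat (K-or-1+K⇒3≤ a∈)
  ... | F1≡a , a∉ = Equivalence.from T-∧
    (subst (T ∘ isPrefix (1 ∷ τ K a ∷ j ∷ [])) (sym flat′)
       (isPrefix-++ (1 ∷ τ K a ∷ j ∷ []) (map (τ K) u)) ,
     subst (λ s → T (s ≡ᵇ c)) (sym stat-preserved) stat≡c)
    where
    open ≡-Reasoning
    Flatten-conj′ : Flatten N (conj π) ≡ map (τ K) (Flatten N π)
    Flatten-conj′ = Flatten-conj π↭ (subst (λ b → b ≡ K ⊎ b ≡ suc K) (sym F1≡a) a∈)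
    j≢K : j ≢ K
    j≢K = <⇒≢ j<K
    j≢1+K : j ≢ suc K
    j≢1+K = <⇒≢ (m<n⇒m<1+n j<K)
    flat′ : Flatten N (conj π) ≡ 1 ∷ τ K a ∷ j ∷ map (τ K) u
    flat′ = begin
      Flatten N (conj π)              ≡⟨ Flatten-conj′ ⟩
      map (τ K) (Flatten N π)         ≡⟨ cong (map (τ K)) flat ⟩
      1 ∷ τ K a ∷ τ K j ∷ map (τ K) u ≡⟨ cong (λ t → 1 ∷ τ K a ∷ t ∷ map (τ K) u) (τ-fixes K j j≢K j≢1+K) ⟩
      1 ∷ τ K a ∷ j ∷ map (τ K) u     ∎
    linked : Linked (NotTransposed K) (1 ∷ a ∷ j ∷ u)
    linked = NotTransposed-outsideˡ (λ ()) (λ ())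
           ∷ NotTransposed-sym (NotTransposed-outsideˡ j≢K j≢1+K)
           ∷ Linked-NotTransposed K a (j ∷ u) a∈ a∉
    stat-preserved : stat st (Flatten N (conj π)) ≡ stat st (Flatten N π)
    stat-preserved = begin
      stat st (Flatten N (conj π))       ≡⟨ cong (stat st) Flatten-conj′ ⟩
      stat st (map (τ K) (Flatten N π))  ≡⟨ cong (stat st ∘ map (τ K)) flat ⟩
      stat st (map (τ K) (1 ∷ a ∷ j ∷ u)) ≡⟨ stat-map-τ K st _ linked ⟩
      stat st (1 ∷ a ∷ j ∷ u)            ≡⟨ cong (stat st) flat ⟨
      stat st (Flatten N π)              ∎

  coeff-conj : ∀ st c → coeff st N (1 ∷ suc K ∷ j ∷ []) c ≡ coeff st N (1 ∷ K ∷ j ∷ []) c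
  coeff-conj st c = count-orderings-involution conj (range1 N) (range1-unique N) conj-involutive conj-↭
    (Counted st c (suc K)) (Counted st c K) counted-conj
    where
    counted-conj : ∀ {π} → π ↭ range1 N → Counted st c (suc K) π ≡ Counted st c K (conj π)
    counted-conj {π} π↭ = T-injective
      (subst (λ b → T (Counted st c b (conj π))) (τ-right K) ∘ transfer π↭ st c (suc K) (inj₂ refl))
      (subst (T ∘ Counted st c (suc K)) (conj-involutive π) ∘
       subst (λ b → T (Counted st c b (conj (conj π)))) (τ-left K) ∘ transfer (conj-↭ π↭) st c K (inj₁ refl))

g-step : ∀ st n i j → 2 ≤ j → j < i → suc i ≤ n →
  g st n (1 ∷ suc i ∷ j ∷ []) ≡ g st n (1 ∷ i ∷ j ∷ [])
g-step st n (suc (suc k)) j 2≤j j<i 1+i≤n with m≤n⇒∃[o]m+o≡n 1+i≤n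
... | e , refl = map-cong (Conjugation.coeff-conj k e j 2≤j j<i st) (upTo (suc n))
g-step st n (suc zero) (suc (suc j)) _ (s≤s ()) _

g-descend : ∀ st n j d → 2 ≤ j → suc (d + j) ≤ n →
  g st n (1 ∷ suc (d + j) ∷ j ∷ []) ≡ g st n (1 ∷ suc j ∷ j ∷ [])
g-descend st n j zero _ _ = refl
g-descend st n j (suc d) 2≤j bound =
  trans (g-step st n (suc (d + j)) j 2≤j (s≤s (m≤n+m j d)) bound)
        (g-descend st n j d 2≤j (≤-trans (n≤1+n _) bound))

lemma3p2 : (n : ℕ) → 4 ≤ n → (st : Stat) → (i j : ℕ) → 2 ≤ j → j < i → i ≤ n →
    g st n (1 ∷ i ∷ j ∷ []) ≡ g st n (1 ∷ suc j ∷ j ∷ [])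
lemma3p2 n _ st i j 2≤j j<i i≤n with m≤n⇒∃[o]m+o≡n j<i
... | d , refl rewrite +-comm j d = g-descend st n j d 2≤j i≤n
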